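{- Let $T$ be a prae-dilator and let $(X,\iota_X,L_X)$ be a Bachmann-Howard system for $T$. Then for all $\sigma,\tau\in T_X$: (i) if $\sigma<_{T_X}\tau$ and $[\iota_X]^{<\omega}(\operatorname{supp}^T_X(\sigma))<^{\operatorname{fin}}_{\vartheta_T(X)}\vartheta_X(\tau)$, then $\vartheta_X(\sigma)<_{\vartheta_T(X)}\vartheta_X(\tau)$; (ii) $[\iota_X]^{<\omega}(\operatorname{supp}^T_X(\sigma))<^{\operatorname{fin}}_{\vartheta_T(X)}\vartheta_X(\sigma)$.
   Context: Linear orders are considered with order embeddings as morphisms. For a set $X$ let $[X]^{<\omega}$ be the set of finite subsets of $X$, and for a map $f$ let $[f]^{<\omega}(a)=\{f(x)\mid x\in a\}$. A prae-dilator is an endofunctor $X\mapsto T_X$, $f\mapsto T_f$ on the category of linear orders together with a natural transformation $\operatorname{supp}^T:T\Rightarrow[\cdot]^{<\omega}$ such that for every linear order $X$ and every $\sigma\in T_X$ we have $\sigma\in\operatorname{rng}(T_{\iota_\sigma})$, where $\iota_\sigma:\operatorname{supp}^T_X(\sigma)\hookrightarrow X$ is the inclusion of the suborder. For a linear order $Z$ and finite $a,b\subseteq Z$ write $a<^{\operatorname{fin}}_Z b$ iff for every $s\in a$ there is $t\in b$ with $s<_Z t$; $\leq^{\operatorname{fin}}_Z$ is defined analogously, and singletons $\{s\}$ are written as $s$. For a linear order $X$, $\vartheta_T(X)$ is the set of formal terms $\vartheta\sigma$ with $\sigma\in T_X$. A Bachmann-Howard system for $T$ is a triple $(X,\iota_X,L_X)$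 of a linear order $X$ and functions $\iota_X:X\to\vartheta_T(X)$, $L_X:X\to\omega$ such that $L_{\vartheta_T(X)}\circ\iota_X=L_X$, where $L_{\vartheta_T(X)}(\vartheta\sigma):=\max\{L_X(x)\mid x\in\operatorname{supp}^T_X(\sigma)\}+1$ (with $\max\emptyset=0$). The linear order $<_{\vartheta_T(X)}$ on $\vartheta_T(X)$ is defined by recursion on $L_{\vartheta_T(X)}(\vartheta\sigma)+L_{\vartheta_T(X)}(\vartheta\tau)$: $\vartheta\sigma<_{\vartheta_T(X)}\vartheta\tau$ iff either (i) $\sigma<_{T_X}\tau$ and $[\iota_X]^{<\omega}(\operatorname{supp}^T_X(\sigma))<^{\operatorname{fin}}_{\vartheta_T(X)}\vartheta\tau$, or (ii) $\tau<_{T_X}\sigma$ and $\vartheta\sigma\leq^{\operatorname{fin}}_{\vartheta_T(X)}[\iota_X]^{<\omega}(\operatorname{supp}^T_X(\tau))$. The function $\vartheta_X:T_X\to\vartheta_T(X)$ is $\vartheta_X(\sigma)=\vartheta\sigma$. -}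

module Defs where

open import Level using (0ℓ)
open import Data.Nat using (ℕ; suc; _⊔_)
open import Data.Product using (Σ; ∃; _×_; _,_; proj₁)
open import Data.Sum using (_⊎_)
open import Data.List using (List; map; foldr; [_])
open import Data.List.Relation.Unary.All using (All)
open import Data.List.Relation.Unary.Any using (Any)
open import Relation.Binary.Bundles using (StrictTotalOrder)
open import Relation.Binary.PropositionalEquality using (_≡_)
import Relation.Binary.Construct.On as On

LinOrd : Set₁
LinOrd = StrictTotalOrder 0ℓ 0ℓ 0ℓ

∣_∣ : LinOrd → Set
∣ X ∣ = StrictTotalOrder.Carrier X

Eq : (X : LinOrd) → ∣ X ∣ → ∣ X ∣ → Set
Eq X = StrictTotalOrder._≈_ X

Lt : (X : LinOrd) → ∣ X ∣ → ∣ X ∣ → Set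
Lt X = StrictTotalOrder._<_ X

record Emb (X Y : LinOrd) : Set where
  field
    fun  : ∣ X ∣ → ∣ Y ∣
    cong : ∀ {x y} → Eq X x y → Eq Y (fun x) (fun y)
    mono : ∀ {x y} → Lt X x y → Lt Y (fun x) (fun y)
open Emb public

idEmb : (X : LinOrd) → Emb X X
idEmb X = record { fun = λ x → x ; cong = λ p → p ; mono = λ p → p }

_∘E_ : ∀ {X Y Z} → Emb Y Z → Emb X Y → Emb X Z
g ∘E f = record { fun = λ x → fun g (fun f x)
                ; cong = λ p → cong g (cong f p)
                ; mono = λ p → mono g (mono f p) }

-- Finite subsets [X]^{<ω}: lists, considered up to (setoid) set equality

Mem : (X : LinOrd) → ∣ X ∣ → List ∣ X ∣ → Set
Mem X x a = Any (Eq X x) a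

SetEq : (X : LinOrd) → List ∣ X ∣ → List ∣ X ∣ → Set
SetEq X a b = ∀ x → (Mem X x a → Mem X x b) × (Mem X x b → Mem X x a)

Sub : (X : LinOrd) → List ∣ X ∣ → LinOrd
Sub X a = On.strictTotalOrder X (proj₁ {B = λ x → Mem X x a})

incl : (X : LinOrd) (a : List ∣ X ∣) → Emb (Sub X a) X
incl X a = record { fun = proj₁ ; cong = λ p → p ; mono = λ p → p }

record PraeDilator : Set₂ where
  field
    T      : LinOrd → LinOrd
    Tmap   : ∀ {X Y} → Emb X Y → ∣ T X ∣ → ∣ T Y ∣
    Tmap-cong : ∀ {X Y} (f : Emb X Y) {σ τ} → Eq (T X) σ τ →
                Eq (T Y) (Tmap f σ) (Tmap f τ)
    Tmap-mono : ∀ {X Y} (f : Emb X Y) {σ τ} → Lt (T X) σ τ →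
                Lt (T Y) (Tmap f σ) (Tmap f τ)
    Tmap-ext  : ∀ {X Y} (f g : Emb X Y) → (∀ x → Eq Y (fun f x) (fun g x)) →
                ∀ σ → Eq (T Y) (Tmap f σ) (Tmap g σ)
    Tmap-id   : ∀ {X} σ → Eq (T X) (Tmap (idEmb X) σ) σ
    Tmap-∘    : ∀ {X Y Z} (g : Emb Y Z) (f : Emb X Y) σ →
                Eq (T Z) (Tmap (g ∘E f) σ) (Tmap g (Tmap f σ))
    supp      : ∀ X → ∣ T X ∣ → List ∣ X ∣
    supp-cong : ∀ X {σ τ} → Eq (T X) σ τ → SetEq X (supp X σ) (supp X τ)
    supp-nat  : ∀ {X Y} (f : Emb X Y) σ →
                SetEq Y (supp Y (Tmap f σ)) (map (fun f) (supp X σ))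
    supp-rng  : ∀ X σ → ∃ λ σ₀ → Eq (T X) (Tmap (incl X (supp X σ)) σ₀) σ

module _ (P : PraeDilator) (X : LinOrd) where
  open PraeDilator P

  data ϑT : Set where
    ϑ : ∣ T X ∣ → ϑT

  _≈ϑ_ : ϑT → ϑT → Set
  ϑ σ ≈ϑ ϑ τ = Eq (T X) σ τ

  maxL : (∣ X ∣ → ℕ) → List ∣ X ∣ → ℕ
  maxL L = foldr (λ x m → L x ⊔ m) 0

  Lϑ : (∣ X ∣ → ℕ) → ϑT → ℕ
  Lϑ L (ϑ σ) = suc (maxL L (supp X σ))

  record BHSystem : Set where
    field
      ι      : ∣ X ∣ → ϑT
      L      : ∣ X ∣ → ℕ
      ι-cong : ∀ {x y} → Eq X x y → ι x ≈ϑ ι y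
      L-cong : ∀ {x y} → Eq X x y → L x ≡ L y
      L-ι    : ∀ x → Lϑ L (ι x) ≡ L x

  -- The order <_{ϑ_T(X)}, given ι.  The recursion on L-sums in the paper is
  -- well founded, so its unique solution is this inductively defined relation.
  module Order (ι : ∣ X ∣ → ϑT) where
    data _<ϑ_ : ϑT → ϑT → Set where
      clause-i  : ∀ {σ τ} → Lt (T X) σ τ →
                  All (λ s → Any (λ t → s <ϑ t) [ ϑ τ ]) (map ι (supp X σ)) →
                  ϑ σ <ϑ ϑ τ
      clause-ii : ∀ {σ τ} → Lt (T X) τ σ →
                  All (λ s → Any (λ t → (s <ϑ t) ⊎ (s ≈ϑ t)) (map ι (supp X τ)))
                      [ ϑ σ ] →
                  ϑ σ <ϑ ϑ τ

    _≤ϑ_ : ϑT → ϑT → Set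
    s ≤ϑ t = (s <ϑ t) ⊎ (s ≈ϑ t)

    _<fin_ : List ϑT → List ϑT → Set
    a <fin b = All (λ s → Any (λ t → s <ϑ t) b) a

    _≤fin_ : List ϑT → List ϑT → Set
    a ≤fin b = All (λ s → Any (λ t → s ≤ϑ t) b) a

  ϑ⟨_⟩ : ∣ T X ∣ → ϑT
  ϑ⟨ σ ⟩ = ϑ σ

-- Clause (ii) of the order is stated against the supports of the terms ι x, so
-- ι x <ϑ ϑσ has to be proved simultaneously for every x in the hereditary support
-- of σ: everything reachable by alternately taking supports and applying ι.
-- Induct on L x + L(ϑσ) and compare the argument ρ of ι x = ϑρ with σ.  If ρ < σ,
-- clause (i) applies, since the support of ρ lies deeper in the hereditary support
-- and has smaller L-value.  If σ < ρ, clause (ii) applies: either x ∈ supp σ itself,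
-- or x lies in the hereditary support of some ι w with w ∈ supp σ, and then
-- ι x < ι w by induction.  If ρ = σ then L x = L(ϑρ) = L(ϑσ) > L x, which is absurd.
module Submission where

open import Defs
open import Data.Empty using (⊥-elim)
open import Data.Product using (_×_; _,_; proj₁)
open import Data.Sum using (inj₁; inj₂)
open import Data.List using (List; []; _∷_; map; [_])
open import Data.List.Membership.Propositional using (_∈_; lose)
open import Data.List.Relation.Unary.Any using (Any; here; there)
import Data.List.Relation.Unary.Any.Properties as Any
open import Data.List.Relation.Unary.All using ([]; _∷_; tabulate)
import Data.List.Relation.Unary.All.Properties as All
open import Data.Nat using (ℕ; zero; suc; _≤_; _<_; _+_; z≤n; s≤s; s≤s⁻¹)
open import Data.Nat.Properties
open import Relation.Binary.PropositionalEquality using (_≡_; refl; sym; subst) renaming (cong to cong-≡)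
open import Relation.Binary.Definitions using (tri<; tri≈; tri>)
open import Relation.Binary.Bundles using (StrictTotalOrder)
open StrictTotalOrder using (compare; module Eq)

module _ (P : PraeDilator) (X : LinOrd) where
  open PraeDilator P

  unϑ : ϑT P X → ∣ T X ∣
  unϑ (ϑ σ) = σ

  suppϑ : ϑT P X → List ∣ X ∣
  suppϑ t = supp X (unϑ t)

  module _ (L : ∣ X ∣ → ℕ) where

    ∈⇒≤maxL : ∀ {x a} → x ∈ a → L x ≤ maxL P X L a
    ∈⇒≤maxL {a = y ∷ a} (here refl) = m≤m⊔n (L y) (maxL P X L a)
    ∈⇒≤maxL {a = y ∷ a} (there x∈a) = ≤-trans (∈⇒≤maxL x∈a) (m≤n⊔m (L y) _)

    module _ (L-cong : ∀ {x y} → Eq X x y → L x ≡ L y) where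

      Mem⇒≤maxL : ∀ {x a} → Mem X x a → L x ≤ maxL P X L a
      Mem⇒≤maxL {a = y ∷ a} (here x≈y) rewrite L-cong x≈y = m≤m⊔n (L y) _
      Mem⇒≤maxL {a = y ∷ a} (there x∈a) = ≤-trans (Mem⇒≤maxL x∈a) (m≤n⊔m (L y) _)

      maxL-mono : ∀ {a b} → (∀ {x} → x ∈ a → Mem X x b) → maxL P X L a ≤ maxL P X L b
      maxL-mono {[]}    a⊆b = z≤n
      maxL-mono {y ∷ a} a⊆b =
        ⊔-lub (Mem⇒≤maxL (a⊆b (here refl))) (maxL-mono (λ x∈a → a⊆b (there x∈a)))

      Lϑ-cong : ∀ {s t} → Eq (T X) (unϑ s) (unϑ t) → Lϑ P X L s ≡ Lϑ P X L t
      Lϑ-cong {ϑ σ} {ϑ τ} σ≈τ =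
        cong-≡ suc (≤-antisym (maxL-mono (supp-⊆ σ≈τ)) (maxL-mono (supp-⊆ (Eq.sym (T X) σ≈τ))))
        where
        supp-⊆ : ∀ {ρ π} → Eq (T X) ρ π → ∀ {x} → x ∈ supp X ρ → Mem X x (supp X π)
        supp-⊆ ρ≈π {x} x∈ = proj₁ (supp-cong X ρ≈π x) (lose x∈ (Eq.refl X))

  module _ (B : BHSystem P X) where
    open BHSystem B
    open Order P X ι

    ≈ϑ-refl : ∀ t → _≈ϑ_ P X t t
    ≈ϑ-refl (ϑ σ) = Eq.refl (T X)

    ∈suppϑ⇒L< : ∀ {x} t → x ∈ suppϑ t → L x < Lϑ P X L t
    ∈suppϑ⇒L< (ϑ σ) x∈ = s≤s (∈⇒≤maxL L x∈)

    <ϑ-clause-i : ∀ {s t} → Lt (T X) (unϑ s) (unϑ t) → map ι (suppϑ s) <fin [ t ] → s <ϑ t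
    <ϑ-clause-i {ϑ σ} {ϑ τ} = clause-i

    <ϑ-clause-ii : ∀ {s t} → Lt (T X) (unϑ t) (unϑ s) → Any (s ≤ϑ_) (map ι (suppϑ t)) → s <ϑ t
    <ϑ-clause-ii {ϑ σ} {ϑ τ} τ<σ s≤ = clause-ii τ<σ (s≤ ∷ [])

    data HeredSupp (t : ϑT P X) : ∣ X ∣ → Set where
      direct : ∀ {x} → x ∈ suppϑ t → HeredSupp t x
      via    : ∀ {w x} → w ∈ suppϑ t → HeredSupp (ι w) x → HeredSupp t x

    HeredSupp-step : ∀ {t z u} → HeredSupp t z → u ∈ suppϑ (ι z) → HeredSupp t u
    HeredSupp-step (direct z∈) u∈ = via z∈ (direct u∈)
    HeredSupp-step (via w∈ z∈) u∈ = via w∈ (HeredSupp-step z∈ u∈)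

    HeredSupp⇒L< : ∀ {t z} → HeredSupp t z → L z < Lϑ P X L t
    HeredSupp⇒L< {t} (direct z∈) = ∈suppϑ⇒L< t z∈
    HeredSupp⇒L< {t} (via {w} w∈ z∈) =
      <-trans (subst (_ <_) (L-ι w) (HeredSupp⇒L< z∈)) (∈suppϑ⇒L< t w∈)

    ∈suppι⇒L< : ∀ {z u} → u ∈ suppϑ (ι z) → L u < L z
    ∈suppι⇒L< {z} u∈ = subst (_ <_) (L-ι z) (∈suppϑ⇒L< (ι z) u∈)

    HeredSupp⇒ι<ϑ : ∀ n {t z} → HeredSupp t z → L z + Lϑ P X L t < n → ι z <ϑ t
    HeredSupp⇒ι<ϑ zero    _ ()
    HeredSupp⇒ι<ϑ (suc n) {t} {z} z∈ z+t<n with compare (T X) (unϑ (ι z)) (unϑ t)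
    ... | tri< ρ<σ _ _ = <ϑ-clause-i ρ<σ (All.map⁺ (tabulate λ u∈ →
            here (HeredSupp⇒ι<ϑ n (HeredSupp-step z∈ u∈)
                    (<-≤-trans (+-monoˡ-< _ (∈suppι⇒L< u∈)) (s≤s⁻¹ z+t<n)))))
    ... | tri≈ _ ρ≈σ _ = ⊥-elim (<-irrefl (sym (L-ι z))
          (subst (L z <_) (Lϑ-cong L L-cong (Eq.sym (T X) ρ≈σ)) (HeredSupp⇒L< z∈)))
    ... | tri> _ _ σ<ρ = <ϑ-clause-ii σ<ρ (ι≤supp z∈)
      where
      ι≤supp : HeredSupp t z → Any (ι z ≤ϑ_) (map ι (suppϑ t))
      ι≤supp (direct z∈)     = Any.map⁺ (lose z∈ (inj₂ (≈ϑ-refl (ι z))))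
      ι≤supp (via {w} w∈ z∈) = Any.map⁺ (lose w∈ (inj₁ (HeredSupp⇒ι<ϑ n z∈
        (<-≤-trans (+-monoʳ-< (L z) (subst (_< _) (sym (L-ι w)) (∈suppϑ⇒L< t w∈))) (s≤s⁻¹ z+t<n)))))

    supp<finϑ : ∀ σ → map ι (supp X σ) <fin [ ϑ σ ]
    supp<finϑ σ = All.map⁺ (tabulate λ x∈ → here (HeredSupp⇒ι<ϑ _ (direct x∈) (n<1+n _)))

proposition3p6 : (P : PraeDilator) (X : LinOrd) (B : BHSystem P X)
    (σ τ : ∣ PraeDilator.T P X ∣) →
    let open PraeDilator P
        open BHSystem B
        open Order P X ι
    in (Lt (T X) σ τ → map ι (supp X σ) <fin [ ϑ⟨_⟩ P X τ ] →
          ϑ⟨_⟩ P X σ <ϑ ϑ⟨_⟩ P X τ)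
       × (map ι (supp X σ) <fin [ ϑ⟨_⟩ P X σ ])
proposition3p6 P X B σ τ = Order.clause-i , supp<finϑ P X B σ
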